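{- Let $G=(V,E)$ be an $n$-vertex graph and $\pi\colon[n]\to V$ a fixed order of its vertices. If the dependency length (the maximum length of a dependency path) with respect to $\pi$ is $2l+1$, then the parallel greedy MIS algorithm run with the order $\pi$ takes at most $l+1$ rounds.
   Context: Parallel greedy MIS with order $\pi$: in each round, every remaining vertex that appears before all its remaining neighbors in $\pi$ is added to the independent set and removed from the graph together with its neighbors, until the graph is empty. Let $V^*\subseteq V$ be the MIS produced by the sequential greedy algorithm that processes $\pi(1),\dots,\pi(n)$ in order, adding a vertex iff none of its neighbors was added before. For $v\notin V^*$, its inhibitor $\mathrm{inhib}(v)$ is the neighbor of $v$ in $V^*$ with minimum position $\pi^{ -1}(\cdot)$. A sequence of positions $1\le p_1<\dots<p_{2l+1}\le n$ ($l\ge 0$) forms a dependency path of length $2l+1$ if (i) $(\pi(p_1),\dots,\pi(p_{2l+1}))$ is a path in $G$; (ii) $\pi(p_k)\in V^*$ for all odd $k$; (iii) $\pi(p_k)\notin V^*$ for all even $k$; (iv) $\pi(p_{k-1})=\mathrm{inhib}(\pi(p_k))$ for all even $k$. -}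

module Defs where

open import Data.Nat using (ℕ; zero; suc)
open import Data.Bool using (Bool; true; false; not; _∧_; _∨_; if_then_else_)
open import Data.Fin using (Fin; _<_; _≤_; _<?_)
open import Data.List using (List; []; _∷_; map; length)
open import Data.Bool.ListAction using (any; all)
open import Data.List.Relation.Unary.Linked using (Linked)
open import Data.Product using (_×_)
open import Data.Empty using (⊥)
open import Relation.Binary.PropositionalEquality using (_≡_)
open import Relation.Nullary.Decidable using (⌊_⌋)
open import Function.Bundles using (_↔_; Inverse)
open import Data.List.Base using () renaming (allFin to allFinL)

record Graph (n : ℕ) : Set where
  field
    adj   : Fin n → Fin n → Bool
    sym   : ∀ u v → adj u v ≡ adj v u
    irrefl : ∀ v → adj v v ≡ false
open Graph public

VSet : ℕ → Set
VSet n = Fin n → Bool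

module Greedy {n : ℕ} (G : Graph n) (π : Fin n ↔ Fin n) where
  -- π maps positions (0-based) to vertices; pos = π⁻¹.
  vtx : Fin n → Fin n
  vtx = Inverse.to π
  pos : Fin n → Fin n
  pos = Inverse.from π

  hasNbrIn : Fin n → VSet n → Bool
  hasNbrIn v S = any (λ u → adj G v u ∧ S u) (allFinL n)

  insert : Fin n → VSet n → VSet n
  insert v S u = if ⌊ Data.Fin._≟_ u v ⌋ then true else S u

  seqRun : List (Fin n) → VSet n → VSet n
  seqRun []       S = S
  seqRun (v ∷ vs) S = seqRun vs (if hasNbrIn v S then S else insert v S)

  Vstar : VSet n
  Vstar = seqRun (map vtx (allFinL n)) (λ _ → false)

  IsInhib : Fin n → Fin n → Set
  IsInhib u v = (Vstar u ≡ true) × (adj G u v ≡ true)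
              × (∀ w → Vstar w ≡ true → adj G w v ≡ true → pos u ≤ pos w)

  -- ---------- dependency paths (sequences of positions) ----------
  -- Conditions (ii)-(iv), forcing odd length: 1st, 3rd, ... in V*,
  -- 2nd, 4th, ... not in V* with the preceding vertex as inhibitor.
  Alt : List (Fin n) → Set
  Alt []              = ⊥
  Alt (p ∷ [])        = Vstar (vtx p) ≡ true
  Alt (p ∷ q ∷ rest)  = (Vstar (vtx p) ≡ true) × (Vstar (vtx q) ≡ false)
                      × IsInhib (vtx p) (vtx q) × Alt rest

  IsDepPath : List (Fin n) → Set
  IsDepPath ps = Linked _<_ ps
               × Linked (λ p q → adj G (vtx p) (vtx q) ≡ true) ps
               × Alt ps

  localMin : VSet n → VSet n
  localMin R v = R v ∧ all (λ u → not (R u ∧ adj G v u) ∨ ⌊ pos v <? pos u ⌋) (allFinL n)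

  round : VSet n → VSet n
  round R v = R v ∧ not (localMin R v) ∧ not (hasNbrIn v (localMin R))

  rounds : ℕ → VSet n → VSet n
  rounds zero    R = R
  rounds (suc k) R = rounds k (round R)

  DoneWithin : ℕ → Set
  DoneWithin k = ∀ v → rounds k (λ _ → true) v ≡ false

-- Let R_k be the set of vertices remaining after k rounds. Throughout the run, a vertex of V*
-- that has left takes its whole neighbourhood with it. Hence every local minimum of R_k lies
-- in V*, and a remaining vertex outside V* keeps its inhibitor in R_k. A vertex v of V* that
-- survives round k+1 was not a local minimum of R_k: it has an earlier remaining neighbour
-- x ∉ V*, whose inhibitor u ∈ V* is earlier still and also remains in R_k. By induction a
-- dependency path of length 2k+1 ends at u, and appending x, v gives one of length 2k+3 ending
-- at v. So a vertex surviving l+1 rounds yields a dependency path longer than 2l+1.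
module Submission where

open import Defs hiding (sym)

open import Data.Bool using (Bool; true; false; not; _∧_; _∨_; if_then_else_)
  renaming (_≟_ to _≟ᵇ_)
open import Data.Bool.Properties using (∧-conicalˡ; ∧-conicalʳ; ¬-not; not-¬; T-≡)
open import Data.Bool.ListAction using (any; all)
open import Data.Empty using (⊥-elim)
open import Data.Fin as F using (Fin; zero; suc; _<?_)
import Data.Fin.Properties as F
open import Data.List using (List; []; _∷_; _∷ʳ_; length; tabulate)
open import Data.List.Base using () renaming (allFin to allFinL)
open import Data.List.Properties using (length-++; map-tabulate)
open import Data.List.Membership.Propositional using (lose)
open import Data.List.Membership.Propositional.Properties using (∈-allFin)
open import Data.List.Relation.Unary.All as All using ()
open import Data.List.Relation.Unary.All.Properties using (all⁺; all⁻)
open import Data.List.Relation.Unary.Any using (satisfied)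
open import Data.List.Relation.Unary.Any.Properties using (any⁺; any⁻)
open import Data.List.Relation.Unary.Linked using (Linked; [-]; _∷_)
open import Data.Nat using (ℕ; zero; suc; _+_; _*_; _≤_; _<_; z≤n; s≤s)
import Data.Nat.Properties as ℕ
open import Data.Product using (_×_; _,_; proj₁; ∃-syntax)
open import Data.Sum using (_⊎_; inj₁; inj₂)
open import Function.Base using (_∘_; id)
open import Function.Bundles using (_↔_; Inverse; Injection; Equivalence)
open import Function.Properties.Inverse using (Inverse⇒Injection)
open import Relation.Binary.Definitions using (tri<; tri≈; tri>)
open import Relation.Binary.PropositionalEquality
  using (_≡_; _≢_; refl; sym; trans; cong; cong₂; subst; subst₂; module ≡-Reasoning)
open import Relation.Nullary using (¬_; Dec; yes; no)
open import Relation.Nullary.Decidable using (⌊_⌋)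

not-≡-true : ∀ {b} → not b ≡ true → b ≡ false
not-≡-true {false} _ = refl
not-≡-true {true} ()

not-≡-false : ∀ {b} → not b ≡ false → b ≡ true
not-≡-false {true} _ = refl
not-≡-false {false} ()

implication-true : ∀ a b {P : Set} (d : Dec P) →
                   not (a ∧ b) ∨ ⌊ d ⌋ ≡ true → a ≡ true → b ≡ true → P
implication-true true true (yes p) _ _ _ = p
implication-true true true (no _) () _ _

implication-false : ∀ a b {P : Set} (d : Dec P) →
                    not (a ∧ b) ∨ ⌊ d ⌋ ≡ false → a ≡ true × b ≡ true × ¬ P
implication-false true true (no ¬p) _ = refl , refl , ¬p
implication-false true true (yes _) ()
implication-false true false _ ()
implication-false false _ _ ()

∧-not-not-true : ∀ a b c → a ∧ not b ∧ not c ≡ true → a ≡ true × b ≡ false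
∧-not-not-true true false false _ = refl , refl
∧-not-not-true true false true ()
∧-not-not-true true true _ ()
∧-not-not-true false _ _ ()

∧-not-not-false : ∀ a b c → a ∧ not b ∧ not c ≡ false → a ≡ false ⊎ b ≡ true ⊎ c ≡ true
∧-not-not-false false _ _ _ = inj₁ refl
∧-not-not-false true true _ _ = inj₂ (inj₁ refl)
∧-not-not-false true false true _ = inj₂ (inj₂ refl)

∧-not-not-falseʳ : ∀ a b c → c ≡ true → a ∧ not b ∧ not c ≡ false
∧-not-not-falseʳ false _ _ _ = refl
∧-not-not-falseʳ true true _ _ = refl
∧-not-not-falseʳ true false true _ = refl

module _ {m : ℕ} (p : Fin m → Bool) where

  any-allFin⁻ : any p (allFinL m) ≡ true → ∃[ i ] p i ≡ true
  any-allFin⁻ e =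
    let i , pi = satisfied (any⁻ p (allFinL m) (Equivalence.from T-≡ e)) in
    i , Equivalence.to T-≡ pi

  any-allFin⁺ : ∀ i → p i ≡ true → any p (allFinL m) ≡ true
  any-allFin⁺ i e = Equivalence.to T-≡ (any⁺ p (lose (∈-allFin i) (Equivalence.from T-≡ e)))

  all-allFin⁻ : all p (allFinL m) ≡ true → ∀ i → p i ≡ true
  all-allFin⁻ e i =
    Equivalence.to T-≡ (All.lookup (all⁺ p (allFinL m) (Equivalence.from T-≡ e)) (∈-allFin i))

  all-allFin-false : all p (allFinL m) ≡ false → ∃[ i ] p i ≡ false
  all-allFin-false e =
    let i , ¬pi = F.¬∀⟶∃¬ m (λ i → p i ≡ true) (λ i → p i ≟ᵇ true) all-true-fails in
    i , ¬-not ¬pi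
    where
    all-true-fails : ¬ (∀ i → p i ≡ true)
    all-true-fails all-true =
      not-¬ (Equivalence.to T-≡ (all⁻ p {allFinL m}
               (All.tabulate λ {i} _ → Equivalence.from T-≡ (all-true i)))) e

least-true : ∀ {m} (p : Fin m → Bool) i → p i ≡ true →
             ∃[ j ] p j ≡ true × (∀ k → p k ≡ true → j F.≤ k)
least-true {suc m} p i pi with p zero in p0
... | true = zero , p0 , λ _ _ → z≤n
least-true p zero pi | false = ⊥-elim (not-¬ pi p0)
least-true p (suc i) pi | false =
  let j , pj , j-least = least-true (p ∘ suc) i pi in
  suc j , pj , λ { zero pk → ⊥-elim (not-¬ pk p0) ; (suc k) pk → s≤s (j-least k pk) }

Linked-∷ʳ : ∀ {A : Set} {R : A → A → Set} xs {a b} →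
            Linked R (xs ∷ʳ a) → R a b → Linked R (xs ∷ʳ a ∷ʳ b)
Linked-∷ʳ [] [-] r = r ∷ [-]
Linked-∷ʳ (_ ∷ []) (r ∷ [-]) r′ = r ∷ r′ ∷ [-]
Linked-∷ʳ (_ ∷ y ∷ xs) (r ∷ rs) r′ = r ∷ Linked-∷ʳ (y ∷ xs) rs r′

length-∷ʳ : ∀ {A : Set} (xs : List A) x → length (xs ∷ʳ x) ≡ suc (length xs)
length-∷ʳ xs x = trans (length-++ xs) (ℕ.+-comm (length xs) 1)

length-∷ʳ-∷ʳ : ∀ {A : Set} (qs : List A) {a b k} → length qs ≡ 2 * k →
               length (qs ∷ʳ a ∷ʳ b) ≡ 2 * suc k
length-∷ʳ-∷ʳ qs {a} {b} {k} length-qs = begin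
  length (qs ∷ʳ a ∷ʳ b)  ≡⟨ length-∷ʳ (qs ∷ʳ a) b ⟩
  suc (length (qs ∷ʳ a)) ≡⟨ cong suc (length-∷ʳ qs a) ⟩
  suc (suc (length qs))  ≡⟨ cong (λ m → suc (suc m)) length-qs ⟩
  suc (suc (2 * k))      ≡⟨ sym (ℕ.*-suc 2 k) ⟩
  2 * suc k              ∎
  where open ≡-Reasoning

module SequentialGreedy {n : ℕ} (G : Graph n) (π : Fin n ↔ Fin n) where
  open Greedy G π

  vtx-pos : ∀ v → vtx (pos v) ≡ v
  vtx-pos = Inverse.strictlyInverseˡ π

  pos-vtx : ∀ p → pos (vtx p) ≡ p
  pos-vtx = Inverse.strictlyInverseʳ π

  vtx-injective : ∀ {i j} → vtx i ≡ vtx j → i ≡ j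
  vtx-injective = Injection.injective (Inverse⇒Injection π)

  pos-injective : ∀ {u v} → pos u ≡ pos v → u ≡ v
  pos-injective {u} {v} eq = trans (sym (vtx-pos u)) (trans (cong vtx eq) (vtx-pos v))

  at-pos : (P : Fin n → Set) → ∀ {v} → P v → P (vtx (pos v))
  at-pos P {v} = subst P (sym (vtx-pos v))

  at-pos₂ : (P : Fin n → Fin n → Set) → ∀ {u v} → P u v → P (vtx (pos u)) (vtx (pos v))
  at-pos₂ P {u} {v} = subst₂ P (sym (vtx-pos u)) (sym (vtx-pos v))

  Adjacent : Fin n → Fin n → Set
  Adjacent u v = adj G u v ≡ true

  adj-sym : ∀ {u v} → Adjacent u v → Adjacent v u
  adj-sym {u} {v} uv = trans (Graph.sym G v u) uv

  adj-≢ : ∀ {u v} → Adjacent u v → u ≢ v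
  adj-≢ {u} uv refl = not-¬ uv (Graph.irrefl G u)

  hasNbrIn-witness : ∀ {v S} → hasNbrIn v S ≡ true → ∃[ u ] Adjacent v u × S u ≡ true
  hasNbrIn-witness {v} {S} e =
    let u , q = any-allFin⁻ (λ u → adj G v u ∧ S u) e in
    u , ∧-conicalˡ _ _ q , ∧-conicalʳ _ _ q

  hasNbrIn-intro : ∀ {v S u} → Adjacent v u → S u ≡ true → hasNbrIn v S ≡ true
  hasNbrIn-intro {v} {S} {u} vu u∈ = any-allFin⁺ (λ u → adj G v u ∧ S u) u (cong₂ _∧_ vu u∈)

  hasNbrIn-false : ∀ {v S u} → hasNbrIn v S ≡ false → S u ≡ true → adj G v u ≡ false
  hasNbrIn-false none u∈ = ¬-not λ vu → not-¬ (hasNbrIn-intro vu u∈) none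

  step : Fin n → VSet n → VSet n
  step v S = if hasNbrIn v S then S else insert v S

  step-⊇ : ∀ v S {u} → S u ≡ true → step v S u ≡ true
  step-⊇ v S {u} u∈ with hasNbrIn v S
  ... | true = u∈
  ... | false with u F.≟ v
  ...   | yes _ = refl
  ...   | no _ = u∈

  step-other : ∀ {v S u} → u ≢ v → step v S u ≡ S u
  step-other {v} {S} {u} u≢v with hasNbrIn v S
  ... | true = refl
  ... | false with u F.≟ v
  ...   | yes u≡v = ⊥-elim (u≢v u≡v)
  ...   | no _ = refl

  step-self : ∀ {v S} → S v ≡ false → step v S v ≡ not (hasNbrIn v S)
  step-self {v} {S} v∉ with hasNbrIn v S
  ... | true = v∉
  ... | false with v F.≟ v
  ...   | yes _ = refl
  ...   | no v≢v = ⊥-elim (v≢v refl)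

  step-new : ∀ {v S u} → step v S u ≡ true → S u ≡ false → u ≡ v
  step-new {v} {S} {u} u∈ u∉ with u F.≟ v
  ... | yes u≡v = u≡v
  ... | no u≢v = ⊥-elim (not-¬ (trans (sym (step-other u≢v)) u∈) u∉)

  seqRun-⊇ : ∀ xs S {u} → S u ≡ true → seqRun xs S u ≡ true
  seqRun-⊇ [] S u∈ = u∈
  seqRun-⊇ (x ∷ xs) S u∈ = seqRun-⊇ xs (step x S) (step-⊇ x S u∈)

  run : ∀ {m} → (Fin m → Fin n) → VSet n → VSet n
  run h = seqRun (tabulate h)

  run-frame : ∀ {m} (h : Fin m → Fin n) S {u} → (∀ i → h i ≢ u) → run h S u ≡ S u
  run-frame {zero} h S _ = refl
  run-frame {suc m} h S h≢u =
    trans (run-frame (h ∘ suc) (step (h zero) S) (h≢u ∘ suc)) (step-other (h≢u zero ∘ sym))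

  record Fresh {m} (h : Fin m → Fin n) (S : VSet n) : Set where
    field
      injective : ∀ {i j} → h i ≡ h j → i ≡ j
      undecided : ∀ i → S (h i) ≡ false

  module _ {m} {h : Fin (suc m) → Fin n} {S : VSet n} (fresh : Fresh h S) where
    open Fresh fresh

    tail-≢-head : ∀ i → h (suc i) ≢ h zero
    tail-≢-head i eq = F.0≢1+n (sym (injective eq))

    Fresh-tail : Fresh (h ∘ suc) (step (h zero) S)
    Fresh-tail = record
      { injective = λ eq → F.suc-injective (injective eq)
      ; undecided = λ i → trans (step-other (tail-≢-head i)) (undecided (suc i))
      }

    run-head-settled : run h S (h zero) ≡ step (h zero) S (h zero)
    run-head-settled = run-frame (h ∘ suc) (step (h zero) S) tail-≢-head

    run-head : run h S (h zero) ≡ not (hasNbrIn (h zero) S)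
    run-head = trans run-head-settled (step-self (undecided zero))

  run-avoids-initial : ∀ {m} {h : Fin m → Fin n} {S} → Fresh h S →
                       ∀ i {u} → run h S (h i) ≡ true → S u ≡ true → adj G (h i) u ≡ false
  run-avoids-initial {suc m} fresh zero chosen u∈ =
    hasNbrIn-false (not-≡-true (trans (sym (run-head fresh)) chosen)) u∈
  run-avoids-initial {suc m} {h} {S} fresh (suc i) chosen u∈ =
    run-avoids-initial (Fresh-tail fresh) i chosen (step-⊇ (h zero) S u∈)

  run-no-earlier-neighbour : ∀ {m} {h : Fin m → Fin n} {S} → Fresh h S →
    ∀ i j → run h S (h i) ≡ true → j F.< i → Adjacent (h i) (h j) → run h S (h j) ≡ false
  run-no-earlier-neighbour {suc m} fresh (suc i) zero chosen _ adjacent =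
    ¬-not λ head-chosen → not-¬ adjacent
      (run-avoids-initial (Fresh-tail fresh) i chosen
        (trans (sym (run-head-settled fresh)) head-chosen))
  run-no-earlier-neighbour {suc m} fresh (suc i) (suc j) chosen (s≤s j<i) adjacent =
    run-no-earlier-neighbour (Fresh-tail fresh) i j chosen j<i adjacent

  run-dominated : ∀ {m} {h : Fin m → Fin n} {S} → Fresh h S →
    ∀ i → run h S (h i) ≡ false →
    ∃[ u ] Adjacent (h i) u × run h S u ≡ true × (S u ≡ true ⊎ ∃[ j ] j F.< i × u ≡ h j)
  run-dominated {suc m} {h} {S} fresh zero rejected =
    let u , adjacent , u∈ = hasNbrIn-witness (not-≡-false (trans (sym (run-head fresh)) rejected)) in
    u , adjacent , seqRun-⊇ (tabulate (h ∘ suc)) _ (step-⊇ (h zero) S u∈) , inj₁ u∈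
  run-dominated {suc m} {h} {S} fresh (suc i) rejected
    with run-dominated (Fresh-tail fresh) i rejected
  ... | u , adjacent , chosen , inj₂ (j , j<i , u≡hj) =
    u , adjacent , chosen , inj₂ (suc j , s≤s j<i , u≡hj)
  ... | u , adjacent , chosen , inj₁ u∈ with S u in u∈S
  ...   | true = u , adjacent , chosen , inj₁ u∈S
  ...   | false = u , adjacent , chosen , inj₂ (zero , s≤s z≤n , step-new u∈ u∈S)

  ∅ : VSet n
  ∅ _ = false

  Vstar≡run : Vstar ≡ run vtx ∅
  Vstar≡run = cong (λ xs → seqRun xs ∅) (map-tabulate id vtx)

  Vstar-fresh : Fresh vtx ∅
  Vstar-fresh = record { injective = vtx-injective ; undecided = λ _ → refl }

  Vstar-at-vtx : ∀ p → Vstar (vtx p) ≡ run vtx ∅ (vtx p)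
  Vstar-at-vtx p = cong (λ S → S (vtx p)) Vstar≡run

  Vstar-at-pos : ∀ v → Vstar v ≡ run vtx ∅ (vtx (pos v))
  Vstar-at-pos v = trans (cong Vstar (sym (vtx-pos v))) (Vstar-at-vtx (pos v))

  Vstar-no-earlier-neighbour : ∀ {v u} → Vstar v ≡ true → Adjacent v u → pos u F.< pos v →
                               Vstar u ≡ false
  Vstar-no-earlier-neighbour {v} {u} v∈ vu u<v =
    trans (Vstar-at-pos u)
      (run-no-earlier-neighbour Vstar-fresh (pos v) (pos u)
        (trans (sym (Vstar-at-pos v)) v∈) u<v (at-pos₂ Adjacent vu))

  Vstar-dominated : ∀ {w} → Vstar w ≡ false →
                    ∃[ u ] Adjacent w u × Vstar u ≡ true × pos u F.< pos w
  Vstar-dominated {w} w∉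
    with run-dominated Vstar-fresh (pos w) (trans (sym (Vstar-at-pos w)) w∉)
  ... | _ , wu , chosen , inj₂ (j , j<w , refl) =
    vtx j , subst (λ x → Adjacent x (vtx j)) (vtx-pos w) wu , trans (Vstar-at-vtx j) chosen ,
    subst (F._< pos w) (sym (pos-vtx j)) j<w

  Vstar-independent : ∀ {u v} → Vstar u ≡ true → Vstar v ≡ true → ¬ Adjacent u v
  Vstar-independent {u} {v} u∈ v∈ uv with F.<-cmp (pos u) (pos v)
  ... | tri< u<v _ _ = not-¬ u∈ (Vstar-no-earlier-neighbour v∈ (adj-sym uv) u<v)
  ... | tri≈ _ u≡v _ = adj-≢ uv (pos-injective u≡v)
  ... | tri> _ _ v<u = not-¬ v∈ (Vstar-no-earlier-neighbour u∈ uv v<u)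

  Vstar-neighbour-excluded : ∀ {v x} → Vstar v ≡ true → Adjacent v x → Vstar x ≡ false
  Vstar-neighbour-excluded v∈ vx = ¬-not λ x∈ → Vstar-independent v∈ x∈ vx

  chosenNbrAt : Fin n → Fin n → Bool
  chosenNbrAt w p = Vstar (vtx p) ∧ adj G (vtx p) w

  chosenNbrAt-pos : ∀ {w u} → Vstar u ≡ true → Adjacent u w → chosenNbrAt w (pos u) ≡ true
  chosenNbrAt-pos {w} u∈ uw = at-pos (λ x → Vstar x ∧ adj G x w ≡ true) (cong₂ _∧_ u∈ uw)

  IsInhib-least : ∀ {w} j → chosenNbrAt w j ≡ true →
                  (∀ k → chosenNbrAt w k ≡ true → j F.≤ k) → IsInhib (vtx j) w
  IsInhib-least {w} j j-chosen j-least =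
    ∧-conicalˡ _ _ j-chosen , ∧-conicalʳ _ _ j-chosen ,
    λ y y∈ yw → subst (F._≤ pos y) (sym (pos-vtx j)) (j-least (pos y) (chosenNbrAt-pos y∈ yw))

  inhib-exists : ∀ {w} → Vstar w ≡ false → ∃[ u ] IsInhib u w × pos u F.< pos w
  inhib-exists {w} w∉ =
    let u , wu , u∈ , u<w = Vstar-dominated w∉
        u-chosen = chosenNbrAt-pos u∈ (adj-sym wu)
        j , j-chosen , j-least = least-true (chosenNbrAt w) (pos u) u-chosen
    in vtx j , IsInhib-least j j-chosen j-least
     , subst (F._< pos w) (sym (pos-vtx j)) (ℕ.≤-<-trans (j-least (pos u) u-chosen) u<w)

  Alt-∷ʳ : ∀ qs {p q r} → Alt (qs ∷ʳ p) → Vstar (vtx q) ≡ false → IsInhib (vtx p) (vtx q) →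
           Vstar (vtx r) ≡ true → Alt (qs ∷ʳ p ∷ʳ q ∷ʳ r)
  Alt-∷ʳ [] p∈ q∉ inhib r∈ = p∈ , q∉ , inhib , r∈
  Alt-∷ʳ (_ ∷ []) (_ , _ , _ , ())
  Alt-∷ʳ (_ ∷ _ ∷ qs) (a , b , c , alt) q∉ inhib r∈ = a , b , c , Alt-∷ʳ qs alt q∉ inhib r∈

  IsDepPath-∷ʳ : ∀ qs {u x v} → IsDepPath (qs ∷ʳ pos u) → pos u F.< pos x → pos x F.< pos v →
                 IsInhib u x → Vstar x ≡ false → Adjacent x v → Vstar v ≡ true →
                 IsDepPath (qs ∷ʳ pos u ∷ʳ pos x ∷ʳ pos v)
  IsDepPath-∷ʳ qs (increasing , path , alt) u<x x<v inhib@(_ , ux , _) x∉ xv v∈ =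
    Linked-∷ʳ (qs ∷ʳ _) (Linked-∷ʳ qs increasing u<x) x<v ,
    Linked-∷ʳ (qs ∷ʳ _) (Linked-∷ʳ qs path (at-pos₂ Adjacent ux)) (at-pos₂ Adjacent xv) ,
    Alt-∷ʳ qs alt (at-pos (λ y → Vstar y ≡ false) x∉) (at-pos₂ IsInhib inhib)
                  (at-pos (λ y → Vstar y ≡ true) v∈)

module ParallelGreedy {n : ℕ} (G : Graph n) (π : Fin n ↔ Fin n) where
  open Greedy G π
  open SequentialGreedy G π

  localMin-⊆ : ∀ {R v} → localMin R v ≡ true → R v ≡ true
  localMin-⊆ = ∧-conicalˡ _ _

  precedesNbrsIn : VSet n → Fin n → Fin n → Bool
  precedesNbrsIn R v u = not (R u ∧ adj G v u) ∨ ⌊ pos v <? pos u ⌋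

  localMin-precedes : ∀ {R v u} → localMin R v ≡ true → R u ≡ true → Adjacent v u →
                      pos v F.< pos u
  localMin-precedes {R} {v} {u} v-min =
    implication-true (R u) (adj G v u) (pos v <? pos u)
      (all-allFin⁻ (precedesNbrsIn R v) (∧-conicalʳ (R v) _ v-min) u)

  not-localMin : ∀ {R v} → R v ≡ true → localMin R v ≡ false →
                 ∃[ u ] R u ≡ true × Adjacent v u × pos u F.< pos v
  not-localMin {R} {v} v∈ not-min =
    let u , violates = all-allFin-false (precedesNbrsIn R v)
                         (trans (cong (_∧ all (precedesNbrsIn R v) (allFinL n)) (sym v∈)) not-min)
        u∈ , vu , v≮u = implication-false (R u) (adj G v u) (pos v <? pos u) violates
    in u , u∈ , vu , F.≤∧≢⇒< (ℕ.≮⇒≥ v≮u) (λ eq → adj-≢ vu (sym (pos-injective eq)))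

  round-kept : ∀ {R v} → round R v ≡ true → R v ≡ true × localMin R v ≡ false
  round-kept {R} {v} = ∧-not-not-true (R v) (localMin R v) (hasNbrIn v (localMin R))

  round-removed : ∀ {R v} → round R v ≡ false →
                  R v ≡ false ⊎ localMin R v ≡ true ⊎ hasNbrIn v (localMin R) ≡ true
  round-removed {R} {v} = ∧-not-not-false (R v) (localMin R v) (hasNbrIn v (localMin R))

  round-shrinks : ∀ {R v} → R v ≡ false → round R v ≡ false
  round-shrinks {R} {v} = cong (λ b → b ∧ not (localMin R v) ∧ not (hasNbrIn v (localMin R)))

  round-removes-neighbours : ∀ {R v} → hasNbrIn v (localMin R) ≡ true → round R v ≡ false
  round-removes-neighbours {R} {v} = ∧-not-not-falseʳ (R v) (localMin R v) _

  rounds-suc : ∀ k R → rounds (suc k) R ≡ round (rounds k R)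
  rounds-suc zero R = refl
  rounds-suc (suc k) R = rounds-suc k (round R)

  Closed : VSet n → Set
  Closed R = ∀ {u v} → Vstar u ≡ true → R u ≡ false → Adjacent u v → R v ≡ false

  localMin-Vstar : ∀ {R v} → Closed R → localMin R v ≡ true → Vstar v ≡ true
  localMin-Vstar {R} {v} closed v-min with Vstar v in v∈
  ... | true = refl
  ... | false with Vstar-dominated v∈
  ...   | u , vu , u∈ , u<v with R u in u∈R
  ...     | true = ⊥-elim (F.<-asym u<v (localMin-precedes v-min u∈R vu))
  ...     | false = ⊥-elim (not-¬ (localMin-⊆ v-min) (closed u∈ u∈R (adj-sym vu)))

  round-Closed : ∀ {R} → Closed R → Closed (round R)
  round-Closed {R} closed {u} {v} u∈ u-gone uv with round-removed {R} u-gone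
  ... | inj₁ u∉R = round-shrinks {R} (closed u∈ u∉R uv)
  ... | inj₂ (inj₁ u-min) = round-removes-neighbours {R} (hasNbrIn-intro (adj-sym uv) u-min)
  ... | inj₂ (inj₂ u-near-min) =
    let x , ux , x-min = hasNbrIn-witness u-near-min in
    ⊥-elim (Vstar-independent u∈ (localMin-Vstar closed x-min) ux)

  remaining : ℕ → VSet n
  remaining k = rounds k (λ _ → true)

  remaining-suc : ∀ k v → remaining (suc k) v ≡ round (remaining k) v
  remaining-suc k v = cong (λ S → S v) (rounds-suc k (λ _ → true))

  remaining-Closed : ∀ k → Closed (remaining k)
  remaining-Closed k = go k (λ _ ())
    where
    go : ∀ k {R} → Closed R → Closed (rounds k R)
    go zero closed = closed
    go (suc k) closed = go k (round-Closed closed)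

  remaining-keeps-inhibitor : ∀ k {u x} → IsInhib u x → remaining k x ≡ true → remaining k u ≡ true
  remaining-keeps-inhibitor k (u∈ , ux , _) x-survives =
    ¬-not λ u-gone → not-¬ x-survives (remaining-Closed k u∈ u-gone ux)

  dependencyPath-to : ∀ k {v} → Vstar v ≡ true → remaining k v ≡ true →
                      ∃[ qs ] IsDepPath (qs ∷ʳ pos v) × length qs ≡ 2 * k
  dependencyPath-to zero v∈ _ = [] , ([-] , [-] , at-pos (λ y → Vstar y ≡ true) v∈) , refl
  dependencyPath-to (suc k) {v} v∈ survives =
    let v∈R , v-not-min = round-kept {R} {v} (trans (sym (remaining-suc k v)) survives)
        x , x∈R , vx , x<v = not-localMin {R} {v} v∈R v-not-min
        x∉ = Vstar-neighbour-excluded v∈ vx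
        u , inhib , u<x = inhib-exists {x} x∉
        u∈ , _ = inhib
        qs , path , length-qs = dependencyPath-to k u∈ (remaining-keeps-inhibitor k inhib x∈R)
    in qs ∷ʳ pos u ∷ʳ pos x
     , IsDepPath-∷ʳ qs path u<x x<v inhib x∉ (adj-sym vx) v∈
     , length-∷ʳ-∷ʳ qs length-qs
    where
    R = remaining k

  survivor-in-Vstar : ∀ k {v} → remaining k v ≡ true → ∃[ u ] Vstar u ≡ true × remaining k u ≡ true
  survivor-in-Vstar k {v} survives with Vstar v in v∈
  ... | true = v , v∈ , survives
  ... | false = let u , inhib , _ = inhib-exists v∈ in
                u , proj₁ inhib , remaining-keeps-inhibitor k inhib survives

  dependencyPath-from-survivor : ∀ k {v} → remaining k v ≡ true →
                                 ∃[ ps ] IsDepPath ps × length ps ≡ 2 * k + 1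
  dependencyPath-from-survivor k survives =
    let u , u∈ , u-survives = survivor-in-Vstar k survives
        qs , path , length-qs = dependencyPath-to k u∈ u-survives
    in qs ∷ʳ pos u , path
     , trans (length-∷ʳ qs (pos u)) (trans (cong suc length-qs) (ℕ.+-comm 1 (2 * k)))

lemma1 : ∀ (n : ℕ) (G : Graph n) (π : Fin n ↔ Fin n) (l : ℕ)
    → (∃[ ps ] (Greedy.IsDepPath G π ps × length ps ≡ 2 * l + 1))
    → (∀ (ps : List (Fin n)) → Greedy.IsDepPath G π ps → length ps ≤ 2 * l + 1)
    → Greedy.DoneWithin G π (suc l)
lemma1 n G π l _ maximal v = ¬-not survives-fails
  where
  open ParallelGreedy G π
  longer : 2 * l + 1 < 2 * suc l + 1
  longer = ℕ.+-monoˡ-< 1 (ℕ.*-monoʳ-< 2 (ℕ.n<1+n l))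
  survives-fails : remaining (suc l) v ≢ true
  survives-fails survives =
    let ps , path , length-ps = dependencyPath-from-survivor (suc l) survives in
    ℕ.<⇒≱ (subst (2 * l + 1 <_) (sym length-ps) longer) (maximal ps path)
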